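{- Let $d$ be a positive integer that is not a perfect square and let $L$ be a positive integer. Let $a, b$ be coprime positive integers and put $k = a^2 - d\,b^2$ (so $k\neq 0$). Let $m, l$ be positive integers with $1 \le l \le L$ such that $k$ divides $a\,l + b\,m$, and such that $|m^2 - d\,l^2|$ is minimal among all pairs of positive integers $(m', l')$ with $1 \le l' \le L$ for which $k$ divides $a\,l' + b\,m'$. Define $$\tilde a = \frac{a\,m + d\,b\,l}{|k|}, \qquad \tilde b = \frac{a\,l + b\,m}{|k|}.$$ Then $\tilde a$ and $\tilde b$ are integers and they are coprime.
   Context: This is one step of the paper's "first algorithm with $L$": starting from $a_1 \in \{\lfloor\sqrt d\rfloor, \lfloor\sqrt d\rfloor+1\}$ (whichever makes $|a_1^2-d|$ smaller), $b_1=1$, and given coprime $a_{i-1}, b_{i-1}$ with $a_{i-1}^2 - d b_{i-1}^2 = k_i$, one chooses $(m_{i+1}, l_{i+1})=(m,l)$ as in the statement (with $a=a_{i-1}$, $b=b_{i-1}$, $k=k_i$) and sets $a_i=\tilde a$, $b_i=\tilde b$, $k_{i+1}=(m_{i+1}^2-d\,l_{i+1}^2)/k_i$. -}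

module Defs where

open import Data.Nat using (ℕ)
open import Data.Integer using (ℤ; +_; _*_; _-_; _+_)

pellNorm : ℕ → ℕ → ℕ → ℤ
pellNorm d a b = (+ a) * (+ a) - (+ d) * ((+ b) * (+ b))

lin : ℕ → ℕ → ℕ → ℕ → ℤ
lin a b m l = (+ a) * (+ l) + (+ b) * (+ m)

{-# OPTIONS --safe #-}
-- Put k = a² − d b² and let α, β be the coefficients of (a + b√d)(m + l√d) / |k|.
-- Integrality: b (am + dbl) ≡ a (al + bm) (mod k), and gcd(k, b) = 1 since gcd(a, b) = 1.
-- Coprimality: multiplying α + β√d by the conjugate a − b√d gives ±(m + l√d), so a common
-- divisor g of α and β divides m and l. Then (m/g, l/g) is again admissible, because
-- k ∣ (al + bm)/g = (β/g)|k|, and its norm (m² − dl²)/g² is nonzero as d is not a square;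
-- minimality of |m² − dl²| forces g = 1.
module Submission where

open import Defs
open import Data.Nat using (ℕ; _≤_)
open import Data.Nat.Coprimality using (Coprime)
open import Data.Integer using (ℤ; +_; ∣_∣; _*_; _+_)
open import Data.Integer.Divisibility using (_∣_)
open import Data.Integer.GCD using (gcd)
open import Data.Product using (Σ; _×_; _,_)
open import Relation.Binary.PropositionalEquality using (_≡_)
open import Relation.Nullary using (¬_)
open import Data.Nat using () renaming (_*_ to _ℕ*_)

open import Data.Nat using (zero; suc; s≤s; z≤n; NonZero; ≢-nonZero; ≢-nonZero⁻¹; >-nonZero) renaming (_+_ to _ℕ+_)
import Data.Nat.Properties as ℕ
open import Data.Nat.Divisibility using (divides; quotient; m∣n⇒n≡quotient*m) renaming (_∣_ to _∣ℕ_)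
import Data.Nat.Divisibility as ℕᵈ
import Data.Nat.GCD as ℕ
open import Data.Nat.DivMod using (_/_; m/n*n≡m)
open import Data.Nat.Coprimality using (coprime-divisor; coprime-/gcd)
import Data.Nat.Coprimality as Coprime
open import Data.Integer using (_-_; 0ℤ; +≤+) renaming (_≤_ to _≤ℤ_; ≢-nonZero to ≢-nonZeroℤ)
import Data.Integer.Properties as ℤ
import Data.Integer.Divisibility.Signed as ℤˢ
import Data.Integer.Tactic.RingSolver as ℤ-Ring
import Data.Nat.Tactic.RingSolver as ℕ-Ring
open import Relation.Binary.PropositionalEquality using (_≢_; refl; sym; trans; cong; cong₂; subst; module ≡-Reasoning)
open import Data.Sum using (inj₂)

NonSquare : ℕ → Set
NonSquare d = ∀ (n : ℕ) → ¬ (n ℕ* n ≡ d)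

-- (a + b√d)(m + l√d) = ratPart d a b m l + lin a b m l · √d
ratPart : ℕ → ℕ → ℕ → ℕ → ℕ → ℤ
ratPart d a b m l = (+ a) * (+ m) + (+ d) * ((+ b) * (+ l))

NormMinimal : (d L a b m l : ℕ) → Set
NormMinimal d L a b m l =
  ∀ (m′ l′ : ℕ) → 1 ≤ m′ → 1 ≤ l′ → l′ ≤ L →
    pellNorm d a b ∣ lin a b m′ l′ → ∣ pellNorm d m l ∣ ≤ ∣ pellNorm d m′ l′ ∣

g*g*n≤n⇒g≤1 : ∀ g n .{{_ : NonZero n}} → g ℕ* g ℕ* n ≤ n → g ≤ 1
g*g*n≤n⇒g≤1 zero          n _ = z≤n
g*g*n≤n⇒g≤1 (suc zero)    n _ = s≤s z≤n
g*g*n≤n⇒g≤1 (suc (suc g)) n le with ℕ.*-cancelʳ-≤ (suc (suc g) ℕ* suc (suc g)) 1 n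
                                      (ℕ.≤-trans le (ℕ.≤-reflexive (sym (ℕ.*-identityˡ n))))
... | s≤s ()

1≤m*g⇒1≤m : ∀ m g → 1 ≤ m ℕ* g → 1 ≤ m
1≤m*g⇒1≤m (suc m) g _ = s≤s z≤n

i*∣k∣≡k*n⇒∣i∣≡n : ∀ i k n .{{_ : NonZero ∣ k ∣}} → i * (+ ∣ k ∣) ≡ k * (+ n) → ∣ i ∣ ≡ n
i*∣k∣≡k*n⇒∣i∣≡n i k n eq = ℕ.*-cancelʳ-≡ (∣ i ∣) n (∣ k ∣) (begin
  (∣ i ∣) ℕ* (∣ k ∣)     ≡⟨ ℤ.abs-* i (+ ∣ k ∣) ⟨
  ∣ i * (+ ∣ k ∣) ∣      ≡⟨ cong ∣_∣ eq ⟩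
  ∣ k * (+ n) ∣          ≡⟨ ℤ.abs-* k (+ n) ⟩
  (∣ k ∣) ℕ* n           ≡⟨ ℕ.*-comm (∣ k ∣) n ⟩
  n ℕ* (∣ k ∣)            ∎)
  where open ≡-Reasoning

0≤x⇒quotient*∣k∣≡x : ∀ {k x} (k∣x : k ∣ x) → 0ℤ ≤ℤ x → (+ quotient k∣x) * (+ ∣ k ∣) ≡ x
0≤x⇒quotient*∣k∣≡x {k} {x} k∣x 0≤x = begin
  (+ quotient k∣x) * (+ ∣ k ∣)  ≡⟨ ℤ.pos-* (quotient k∣x) ∣ k ∣ ⟨
  + (quotient k∣x ℕ* ∣ k ∣)     ≡⟨ cong +_ (m∣n⇒n≡quotient*m k∣x) ⟨
  + ∣ x ∣                        ≡⟨ ℤ.0≤i⇒+∣i∣≡i 0≤x ⟩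
  x                              ∎
  where open ≡-Reasoning

coprime-divisorℤ : ∀ {k b x} → Coprime ∣ k ∣ b → k ∣ (+ b) * x → k ∣ x
coprime-divisorℤ {b = b} {x} k⊥b k∣bx = coprime-divisor k⊥b (subst (_ ∣ℕ_) (ℤ.abs-* (+ b) x) k∣bx)

lin≡+ : ∀ a b m l → lin a b m l ≡ + (a ℕ* l ℕ+ b ℕ* m)
lin≡+ a b m l = begin
  (+ a) * (+ l) + (+ b) * (+ m)  ≡⟨ cong₂ _+_ (ℤ.pos-* a l) (ℤ.pos-* b m) ⟨
  + (a ℕ* l) + + (b ℕ* m)        ≡⟨ ℤ.pos-+ (a ℕ* l) (b ℕ* m) ⟨
  + (a ℕ* l ℕ+ b ℕ* m)           ∎
  where open ≡-Reasoning

ratPart≡+ : ∀ d a b m l → ratPart d a b m l ≡ + (a ℕ* m ℕ+ d ℕ* (b ℕ* l))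
ratPart≡+ d a b m l = begin
  (+ a) * (+ m) + (+ d) * ((+ b) * (+ l))  ≡⟨ cong (λ x → (+ a) * (+ m) + (+ d) * x) (ℤ.pos-* b l) ⟨
  (+ a) * (+ m) + (+ d) * + (b ℕ* l)       ≡⟨ cong₂ _+_ (ℤ.pos-* a m) (ℤ.pos-* d (b ℕ* l)) ⟨
  + (a ℕ* m) + + (d ℕ* (b ℕ* l))           ≡⟨ ℤ.pos-+ (a ℕ* m) (d ℕ* (b ℕ* l)) ⟨
  + (a ℕ* m ℕ+ d ℕ* (b ℕ* l))              ∎
  where open ≡-Reasoning

0≤lin : ∀ a b m l → 0ℤ ≤ℤ lin a b m l
0≤lin a b m l = subst (0ℤ ≤ℤ_) (sym (lin≡+ a b m l)) (+≤+ z≤n)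

0≤ratPart : ∀ d a b m l → 0ℤ ≤ℤ ratPart d a b m l
0≤ratPart d a b m l = subst (0ℤ ≤ℤ_) (sym (ratPart≡+ d a b m l)) (+≤+ z≤n)

1≤∣lin∣ : ∀ {a b m l} → 1 ≤ a → 1 ≤ l → 1 ≤ ∣ lin a b m l ∣
1≤∣lin∣ {a} {b} {m} {l} 1≤a 1≤l =
  subst (1 ≤_) (sym (cong ∣_∣ (lin≡+ a b m l))) (ℕ.≤-trans (ℕ.*-mono-≤ 1≤a 1≤l) (ℕ.m≤m+n (a ℕ* l) (b ℕ* m)))

lin-* : ∀ a b m l g → lin a b (m ℕ* g) (l ℕ* g) ≡ lin a b m l * (+ g)
lin-* a b m l g = trans (cong₂ (λ x y → (+ a) * x + (+ b) * y) (ℤ.pos-* l g) (ℤ.pos-* m g))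
                         (identity (+ a) (+ b) (+ m) (+ l) (+ g))
  where
  identity : ∀ A B M L G → A * (L * G) + B * (M * G) ≡ (A * L + B * M) * G
  identity = ℤ-Ring.solve-∀

pellNorm-* : ∀ d m l g → pellNorm d (m ℕ* g) (l ℕ* g) ≡ + (g ℕ* g) * pellNorm d m l
pellNorm-* d m l g =
  trans (cong₂ (λ x y → x * x - (+ d) * (y * y)) (ℤ.pos-* m g) (ℤ.pos-* l g))
        (trans (identity (+ d) (+ m) (+ l) (+ g)) (cong (_* pellNorm d m l) (sym (ℤ.pos-* g g))))
  where
  identity : ∀ D M L G → M * G * (M * G) - D * (L * G * (L * G)) ≡ G * G * (M * M - D * (L * L))
  identity = ℤ-Ring.solve-∀

b*ratPart≡a*lin-l*k : ∀ d a b m l →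
  (+ b) * ratPart d a b m l ≡ (+ a) * lin a b m l - (+ l) * pellNorm d a b
b*ratPart≡a*lin-l*k d a b m l = identity (+ d) (+ a) (+ b) (+ m) (+ l)
  where
  identity : ∀ D A B M L → B * (A * M + D * (B * L)) ≡ A * (A * L + B * M) - L * (A * A - D * (B * B))
  identity = ℤ-Ring.solve-∀

-- The two components of (a - b√d)(a + b√d)(m + l√d) = k (m + l√d).
conjugate-ratPart : ∀ d a b m l →
  (+ a) * ratPart d a b m l - (+ d) * ((+ b) * lin a b m l) ≡ pellNorm d a b * (+ m)
conjugate-ratPart d a b m l = identity (+ d) (+ a) (+ b) (+ m) (+ l)
  where
  identity : ∀ D A B M L → A * (A * M + D * (B * L)) - D * (B * (A * L + B * M)) ≡ (A * A - D * (B * B)) * M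
  identity = ℤ-Ring.solve-∀

conjugate-lin : ∀ d a b m l →
  (+ a) * lin a b m l - (+ b) * ratPart d a b m l ≡ pellNorm d a b * (+ l)
conjugate-lin d a b m l = identity (+ d) (+ a) (+ b) (+ m) (+ l)
  where
  identity : ∀ D A B M L → A * (A * L + B * M) - B * (A * M + D * (B * L)) ≡ (A * A - D * (B * B)) * L
  identity = ℤ-Ring.solve-∀

pellNorm≡0⇒m*m≡d*[l*l] : ∀ d m l → pellNorm d m l ≡ 0ℤ → m ℕ* m ≡ d ℕ* (l ℕ* l)
pellNorm≡0⇒m*m≡d*[l*l] d m l norm≡0 = ℤ.+-injective (begin
  + (m ℕ* m)              ≡⟨ ℤ.pos-* m m ⟩
  (+ m) * (+ m)           ≡⟨ ℤ.i-j≡0⇒i≡j _ _ norm≡0 ⟩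
  (+ d) * ((+ l) * (+ l)) ≡⟨ cong ((+ d) *_) (ℤ.pos-* l l) ⟨
  (+ d) * + (l ℕ* l)      ≡⟨ ℤ.pos-* d (l ℕ* l) ⟨
  + (d ℕ* (l ℕ* l))       ∎)
  where open ≡-Reasoning

coprime∧m*m≡d*[l*l]⇒l≡1 : ∀ {d m l} → Coprime m l → m ℕ* m ≡ d ℕ* (l ℕ* l) → l ≡ 1
coprime∧m*m≡d*[l*l]⇒l≡1 {d} {m} {l} m⊥l eq = m⊥l (l∣m , ℕᵈ.∣-refl)
  where
  l∣m : l ∣ℕ m
  l∣m = coprime-divisor (Coprime.sym m⊥l) (divides (d ℕ* l) (trans eq (sym (ℕ.*-assoc d l l))))

-- Dividing m and l by their gcd reduces to the coprime case.
pellNorm≢0 : ∀ {d m l} → NonSquare d → .{{_ : NonZero l}} → pellNorm d m l ≢ 0ℤ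
pellNorm≢0 {d} {m} {l} nonsq norm≡0 = nonsq m₁ (begin
  m₁ ℕ* m₁         ≡⟨ reduced ⟩
  d ℕ* (l₁ ℕ* l₁)  ≡⟨ cong (λ x → d ℕ* (x ℕ* x)) l₁≡1 ⟩
  d ℕ* 1           ≡⟨ ℕ.*-identityʳ d ⟩
  d                ∎)
  where
  open ≡-Reasoning
  g = ℕ.gcd m l
  instance
    g≢0 : NonZero g
    g≢0 = ≢-nonZero (ℕ.gcd[m,n]≢0 m l (inj₂ (≢-nonZero⁻¹ l)))
  m₁ = m / g
  l₁ = l / g
  norm₁≡0 : pellNorm d m₁ l₁ ≡ 0ℤ
  norm₁≡0 = ℤ.*-cancelˡ-≡ (+ (g ℕ* g)) _ 0ℤ {{ℕ.m*n≢0 g g}} (begin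
    + (g ℕ* g) * pellNorm d m₁ l₁   ≡⟨ pellNorm-* d m₁ l₁ g ⟨
    pellNorm d (m₁ ℕ* g) (l₁ ℕ* g)  ≡⟨ cong₂ (pellNorm d) (m/n*n≡m (ℕ.gcd[m,n]∣m m l)) (m/n*n≡m (ℕ.gcd[m,n]∣n m l)) ⟩
    pellNorm d m l                   ≡⟨ norm≡0 ⟩
    0ℤ                               ≡⟨ ℤ.*-zeroʳ (+ (g ℕ* g)) ⟨
    + (g ℕ* g) * 0ℤ                  ∎)
  reduced : m₁ ℕ* m₁ ≡ d ℕ* (l₁ ℕ* l₁)
  reduced = pellNorm≡0⇒m*m≡d*[l*l] d m₁ l₁ norm₁≡0
  l₁≡1 : l₁ ≡ 1
  l₁≡1 = coprime∧m*m≡d*[l*l]⇒l≡1 {d} (coprime-/gcd m l) reduced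

coprime⇒∣pellNorm∣⊥b : ∀ {d a b} → Coprime a b → Coprime ∣ pellNorm d a b ∣ b
coprime⇒∣pellNorm∣⊥b {d} {a} {b} a⊥b {i} (i∣∣k∣ , i∣b) = a⊥b (i∣a , i∣b)
  where
  identity : ∀ D A B → (A * A - D * (B * B)) + D * (B * B) ≡ A * A
  identity = ℤ-Ring.solve-∀
  i∣k : (+ i) ℤˢ.∣ pellNorm d a b
  i∣k = ℤˢ.∣ᵤ⇒∣ i∣∣k∣
  i∣d*b*b : (+ i) ℤˢ.∣ (+ d) * ((+ b) * (+ b))
  i∣d*b*b = ℤˢ.∣n⇒∣m*n (+ d) (ℤˢ.∣n⇒∣m*n (+ b) (ℤˢ.∣ᵤ⇒∣ i∣b))
  i∣a*a : i ∣ℕ a ℕ* a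
  i∣a*a = subst (i ∣ℕ_) (ℤ.abs-* (+ a) (+ a))
    (ℤˢ.∣⇒∣ᵤ (subst ((+ i) ℤˢ.∣_) (identity (+ d) (+ a) (+ b)) (ℤˢ.∣m∣n⇒∣m+n i∣k i∣d*b*b)))
  i⊥a : Coprime i a
  i⊥a (j∣i , j∣a) = a⊥b (j∣a , ℕᵈ.∣-trans j∣i i∣b)
  i∣a : i ∣ℕ a
  i∣a = coprime-divisor i⊥a i∣a*a

∣lin⇒∣ratPart : ∀ {d a b m l} → Coprime a b → pellNorm d a b ∣ lin a b m l → pellNorm d a b ∣ ratPart d a b m l
∣lin⇒∣ratPart {d} {a} {b} {m} {l} a⊥b k∣lin =
  coprime-divisorℤ {pellNorm d a b} (coprime⇒∣pellNorm∣⊥b {d} a⊥b) (ℤˢ.∣⇒∣ᵤ k∣b*ratPart)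
  where
  k∣a*lin-l*k : pellNorm d a b ℤˢ.∣ (+ a) * lin a b m l - (+ l) * pellNorm d a b
  k∣a*lin-l*k = ℤˢ.∣m∣n⇒∣m-n (ℤˢ.∣n⇒∣m*n (+ a) (ℤˢ.∣ᵤ⇒∣ k∣lin)) (ℤˢ.∣n⇒∣m*n (+ l) ℤˢ.∣-refl)
  k∣b*ratPart : pellNorm d a b ℤˢ.∣ (+ b) * ratPart d a b m l
  k∣b*ratPart = subst (pellNorm d a b ℤˢ.∣_) (sym (b*ratPart≡a*lin-l*k d a b m l)) k∣a*lin-l*k

x*g≡β*∣k∣∧g∣β⇒k∣x : ∀ {k x g β} .{{_ : NonZero g}} → x * (+ g) ≡ (+ β) * (+ ∣ k ∣) → g ∣ℕ β → k ∣ x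
x*g≡β*∣k∣∧g∣β⇒k∣x {k} {x} {g} eq (divides β′ refl) = divides β′ (ℕ.*-cancelʳ-≡ (∣ x ∣) (β′ ℕ* ∣ k ∣) g (begin
  (∣ x ∣) ℕ* g                  ≡⟨ ℤ.abs-* x (+ g) ⟨
  ∣ x * (+ g) ∣                 ≡⟨ cong ∣_∣ eq ⟩
  ∣ (+ (β′ ℕ* g)) * (+ ∣ k ∣) ∣ ≡⟨ ℤ.abs-* (+ (β′ ℕ* g)) (+ ∣ k ∣) ⟩
  β′ ℕ* g ℕ* (∣ k ∣)            ≡⟨ identity β′ g (∣ k ∣) ⟩
  β′ ℕ* (∣ k ∣) ℕ* g            ∎))
  where
  open ≡-Reasoning
  identity : ∀ B G K → B ℕ* G ℕ* K ≡ B ℕ* K ℕ* G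
  identity = ℕ-Ring.solve-∀

module _ {d a b m l α β : ℕ} .{{_ : NonZero ∣ pellNorm d a b ∣}}
         (α*∣k∣≡ratPart : (+ α) * (+ ∣ pellNorm d a b ∣) ≡ ratPart d a b m l)
         (β*∣k∣≡lin : (+ β) * (+ ∣ pellNorm d a b ∣) ≡ lin a b m l) where

  private
    k = pellNorm d a b
    K = + ∣ pellNorm d a b ∣
    open ≡-Reasoning

  ∣α∧∣β⇒∣m : ∀ {c} → c ∣ℕ α → c ∣ℕ β → c ∣ℕ m
  ∣α∧∣β⇒∣m {c} c∣α c∣β = subst (c ∣ℕ_) (i*∣k∣≡k*n⇒∣i∣≡n X k m X*∣k∣≡k*m) (ℤˢ.∣⇒∣ᵤ c∣X)
    where
    X = (+ a) * (+ α) - (+ d) * ((+ b) * (+ β))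
    X*∣k∣≡k*m : X * K ≡ k * (+ m)
    X*∣k∣≡k*m = begin
      X * K                                                    ≡⟨ identity (+ a) (+ α) (+ d) (+ b) (+ β) K ⟩
      (+ a) * ((+ α) * K) - (+ d) * ((+ b) * ((+ β) * K))      ≡⟨ cong₂ (λ u v → (+ a) * u - (+ d) * ((+ b) * v)) α*∣k∣≡ratPart β*∣k∣≡lin ⟩
      (+ a) * ratPart d a b m l - (+ d) * ((+ b) * lin a b m l) ≡⟨ conjugate-ratPart d a b m l ⟩
      k * (+ m)                                                ∎
      where
      identity : ∀ A P D B Q K → (A * P - D * (B * Q)) * K ≡ A * (P * K) - D * (B * (Q * K))
      identity = ℤ-Ring.solve-∀
    c∣X : (+ c) ℤˢ.∣ X
    c∣X = ℤˢ.∣m∣n⇒∣m-n (ℤˢ.∣n⇒∣m*n (+ a) (ℤˢ.∣ᵤ⇒∣ c∣α)) (ℤˢ.∣n⇒∣m*n (+ d) (ℤˢ.∣n⇒∣m*n (+ b) (ℤˢ.∣ᵤ⇒∣ c∣β)))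

  ∣α∧∣β⇒∣l : ∀ {c} → c ∣ℕ α → c ∣ℕ β → c ∣ℕ l
  ∣α∧∣β⇒∣l {c} c∣α c∣β = subst (c ∣ℕ_) (i*∣k∣≡k*n⇒∣i∣≡n Y k l Y*∣k∣≡k*l) (ℤˢ.∣⇒∣ᵤ c∣Y)
    where
    Y = (+ a) * (+ β) - (+ b) * (+ α)
    Y*∣k∣≡k*l : Y * K ≡ k * (+ l)
    Y*∣k∣≡k*l = begin
      Y * K                                          ≡⟨ identity (+ a) (+ β) (+ b) (+ α) K ⟩
      (+ a) * ((+ β) * K) - (+ b) * ((+ α) * K)      ≡⟨ cong₂ (λ u v → (+ a) * v - (+ b) * u) α*∣k∣≡ratPart β*∣k∣≡lin ⟩
      (+ a) * lin a b m l - (+ b) * ratPart d a b m l ≡⟨ conjugate-lin d a b m l ⟩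
      k * (+ l)                                      ∎
      where
      identity : ∀ A Q B P K → (A * Q - B * P) * K ≡ A * (Q * K) - B * (P * K)
      identity = ℤ-Ring.solve-∀
    c∣Y : (+ c) ℤˢ.∣ Y
    c∣Y = ℤˢ.∣m∣n⇒∣m-n (ℤˢ.∣n⇒∣m*n (+ a) (ℤˢ.∣ᵤ⇒∣ c∣β)) (ℤˢ.∣n⇒∣m*n (+ b) (ℤˢ.∣ᵤ⇒∣ c∣α))

minimal⇒common-divisor≤1 : ∀ {d L a b m l g β} → NonSquare d → NormMinimal d L a b m l →
  1 ≤ m → 1 ≤ l → l ≤ L → (+ β) * (+ ∣ pellNorm d a b ∣) ≡ lin a b m l →
  g ∣ℕ m → g ∣ℕ l → g ∣ℕ β → g ≤ 1
minimal⇒common-divisor≤1 {g = zero} _ _ _ _ _ _ _ _ _ = z≤n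
minimal⇒common-divisor≤1 {d} {L} {a} {b} {g = g@(suc _)} {β}
  nonsq minimal 1≤m 1≤l l≤L β*∣k∣≡lin (divides m′ refl) (divides l′ refl) g∣β =
  g*g*n≤n⇒g≤1 g (∣ pellNorm d m′ l′ ∣) {{≢-nonZeroℤ (pellNorm≢0 {d} {m′} {l′} nonsq)}}
    (subst (_≤ ∣ pellNorm d m′ l′ ∣) ∣N∣≡g*g*∣N′∣ (minimal m′ l′ 1≤m′ 1≤l′ l′≤L k∣lin′))
  where
  1≤m′ : 1 ≤ m′
  1≤m′ = 1≤m*g⇒1≤m m′ g 1≤m
  1≤l′ : 1 ≤ l′
  1≤l′ = 1≤m*g⇒1≤m l′ g 1≤l
  instance
    l′≢0 : NonZero l′
    l′≢0 = >-nonZero 1≤l′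
  l′≤L : l′ ≤ L
  l′≤L = ℕ.≤-trans (ℕ.m≤m*n l′ g) l≤L
  k∣lin′ : pellNorm d a b ∣ lin a b m′ l′
  k∣lin′ = x*g≡β*∣k∣∧g∣β⇒k∣x {pellNorm d a b} {lin a b m′ l′} (trans (sym (lin-* a b m′ l′ g)) (sym β*∣k∣≡lin)) g∣β
  ∣N∣≡g*g*∣N′∣ : ∣ pellNorm d (m′ ℕ* g) (l′ ℕ* g) ∣ ≡ g ℕ* g ℕ* ∣ pellNorm d m′ l′ ∣
  ∣N∣≡g*g*∣N′∣ = trans (cong ∣_∣ (pellNorm-* d m′ l′ g)) (ℤ.abs-* (+ (g ℕ* g)) (pellNorm d m′ l′))

proposition6 : (d L a b m l : ℕ) →
    1 ≤ d → (∀ (n : ℕ) → ¬ (n ℕ* n ≡ d)) →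
    1 ≤ L →
    1 ≤ a → 1 ≤ b → Coprime a b →
    1 ≤ m → 1 ≤ l → l ≤ L →
    pellNorm d a b ∣ lin a b m l →
    (∀ (m′ l′ : ℕ) → 1 ≤ m′ → 1 ≤ l′ → l′ ≤ L →
      pellNorm d a b ∣ lin a b m′ l′ →
      ∣ pellNorm d m l ∣ ≤ ∣ pellNorm d m′ l′ ∣) →
    Σ ℤ λ ã → Σ ℤ λ b̃ →
      (ã * (+ ∣ pellNorm d a b ∣) ≡ (+ a) * (+ m) + (+ d) * ((+ b) * (+ l)))
      × (b̃ * (+ ∣ pellNorm d a b ∣) ≡ lin a b m l)
      × gcd ã b̃ ≡ + 1
proposition6 d L a b m l _ nonsq _ 1≤a _ a⊥b 1≤m 1≤l l≤L k∣lin minimal =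
  + α , + β , α*∣k∣≡ratPart , β*∣k∣≡lin , cong +_ gcd[α,β]≡1
  where
  k∣ratPart : pellNorm d a b ∣ ratPart d a b m l
  k∣ratPart = ∣lin⇒∣ratPart {d} a⊥b k∣lin
  α = quotient k∣ratPart
  β = quotient k∣lin
  α*∣k∣≡ratPart : (+ α) * (+ ∣ pellNorm d a b ∣) ≡ ratPart d a b m l
  α*∣k∣≡ratPart = 0≤x⇒quotient*∣k∣≡x {pellNorm d a b} k∣ratPart (0≤ratPart d a b m l)
  β*∣k∣≡lin : (+ β) * (+ ∣ pellNorm d a b ∣) ≡ lin a b m l
  β*∣k∣≡lin = 0≤x⇒quotient*∣k∣≡x {pellNorm d a b} k∣lin (0≤lin a b m l)
  instance
    ∣lin∣≢0 : NonZero ∣ lin a b m l ∣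
    ∣lin∣≢0 = >-nonZero (1≤∣lin∣ {a} {b} 1≤a 1≤l)
    ∣k∣≢0 : NonZero ∣ pellNorm d a b ∣
    ∣k∣≢0 = ℕ.m*n≢0⇒n≢0 β {{subst NonZero (m∣n⇒n≡quotient*m k∣lin) ∣lin∣≢0}}
  gcd[α,β]∣m : ℕ.gcd α β ∣ℕ m
  gcd[α,β]∣m = ∣α∧∣β⇒∣m {d} {a} {b} α*∣k∣≡ratPart β*∣k∣≡lin (ℕ.gcd[m,n]∣m α β) (ℕ.gcd[m,n]∣n α β)
  gcd[α,β]∣l : ℕ.gcd α β ∣ℕ l
  gcd[α,β]∣l = ∣α∧∣β⇒∣l {d} {a} {b} α*∣k∣≡ratPart β*∣k∣≡lin (ℕ.gcd[m,n]∣m α β) (ℕ.gcd[m,n]∣n α β)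
  gcd[α,β]≢0 : ℕ.gcd α β ≢ 0
  gcd[α,β]≢0 = ℕ.gcd[m,n]≢0 α β (inj₂ (≢-nonZero⁻¹ β {{ℕᵈ.quotient≢0 k∣lin}}))
  gcd[α,β]≡1 : ℕ.gcd α β ≡ 1
  gcd[α,β]≡1 = ℕ.≤-antisym
    (minimal⇒common-divisor≤1 {d} {L} {a} {b} nonsq minimal 1≤m 1≤l l≤L β*∣k∣≡lin gcd[α,β]∣m gcd[α,β]∣l (ℕ.gcd[m,n]∣n α β))
    (ℕ.n≢0⇒n>0 gcd[α,β]≢0)
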